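{- Let $(\mathscr{L},W)$ be a logical structure with $W$ monotonic, and let $\mathsf{S}=(\mathbf{B},R_m,\models,\mathcal{P}(\mathscr{L}))$ be the normal $S$-semantics for $\mathscr{L}$ with $\mathbf{B}=\{\chi_\Gamma:\Gamma\subseteq\mathscr{L}\}$ and $R_m=\{(\chi_\Gamma,\chi_{W(\Gamma)}):\Gamma\subseteq\mathscr{L}\}$. Then $W=W^{\mathsf{S}}_I$.
   Context: A logical structure is a pair $(\mathscr{L},W)$ with $\mathscr{L}$ a set and $W:\mathcal{P}(\mathscr{L})\to\mathcal{P}(\mathscr{L})$; $W$ is monotonic if $\Gamma\subseteq\Sigma$ implies $W(\Gamma)\subseteq W(\Sigma)$. For $\Gamma\subseteq\mathscr{L}$, $\chi_\Gamma:\mathscr{L}\to\{0,1\}$ is its characteristic function. An $S$-semantics for $\mathscr{L}$ is a tuple $(\mathbf{B},R,\models,\mathcal{P}(\mathscr{L}))$ with $\mathbf{B}\subseteq\{0,1\}^{\mathscr{L}}$, $R\subseteq\mathbf{B}\times\mathbf{B}$, $\models\subseteq\mathbf{B}\times\mathcal{P}(\mathscr{L})$; it is normal if $v\models\Gamma$ iff $v(\Gamma)\subseteq\{1\}$. The type-I consequence operator $W^{\mathsf{S}}_I$ is defined by: $\alpha\in W^{\mathsf{S}}_I(\Gamma)$ iff for all $(v,w)\in R$, $v\models\Gamma$ implies $w\models\{\alpha\}$. -}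

module Defs where

open import Level using (Level; 0ℓ; suc; _⊔_)
open import Data.Bool using (Bool; true; false)
open import Data.Product using (Σ; _×_; _,_)
open import Relation.Binary.PropositionalEquality using (_≡_)
open import Relation.Unary using (Pred; _∈_; _⊆_; ｛_｝)
open import Function.Bundles using (_⇔_)

𝒫 : Set → Set₁
𝒫 L = Pred L 0ℓ

-- {0,1}^L : valuations, with 0 = false, 1 = true.
Val : Set → Set
Val L = L → Bool

record LogicalStructure : Set₂ where
  field
    𝓛 : Set
    W : 𝒫 𝓛 → 𝒫 𝓛

Monotonic : {L : Set} → (𝒫 L → 𝒫 L) → Set₁
Monotonic {L} W = ∀ {Γ Σ′ : 𝒫 L} → Γ ⊆ Σ′ → W Γ ⊆ W Σ′

IsChar : {L : Set} → Val L → 𝒫 L → Set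
IsChar v Γ = ∀ x → (v x ≡ true) ⇔ (x ∈ Γ)

record SSemantics (L : Set) : Set₂ where
  field
    B   : Pred (Val L) (suc 0ℓ)
    R   : Val L → Val L → Set₁
    R⊆B×B : ∀ {v w} → R v w → B v × B w
    _⊨_ : Val L → 𝒫 L → Set       -- intended: ⊨ ⊆ B × P(L)

Normal : {L : Set} → SSemantics L → Set₁
Normal {L} S = ∀ (v : Val L) (Γ : 𝒫 L) →
  (v ⊨ Γ) ⇔ (∀ x → x ∈ Γ → v x ≡ true)
  where open SSemantics S

W-I : {L : Set} → SSemantics L → 𝒫 L → Pred L (suc 0ℓ)
W-I S Γ α = ∀ v w → R v w → v ⊨ Γ → w ⊨ ｛ α ｝
  where open SSemantics S

Sm : (L : Set) → (𝒫 L → 𝒫 L) → SSemantics L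
Sm L W = record
  { B = λ v → Σ (𝒫 L) (λ Γ → IsChar v Γ)
  ; R = λ v w → Σ (𝒫 L) (λ Γ → IsChar v Γ × IsChar w (W Γ))
  ; R⊆B×B = λ { (Γ , cv , cw) → (Γ , cv) , (W Γ , cw) }
  ; _⊨_ = λ v Γ → ∀ x → x ∈ Γ → v x ≡ true
  }

-- Soundness: a pair (χ_Δ, χ_{W Δ}) in R_m whose first component satisfies Γ has Γ ⊆ Δ, so
-- monotonicity gives W Γ ⊆ W Δ and χ_{W Δ} satisfies every α ∈ W Γ.
-- Completeness: the pair (χ_Γ, χ_{W Γ}) itself lies in R_m and χ_Γ satisfies Γ, so any
-- α ∈ W^S_I(Γ) is true under χ_{W Γ}, i.e. α ∈ W Γ. Excluded middle is needed to build χ_Γ.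
module Submission where

open import Defs
open import Level using (0ℓ)
open import Relation.Unary using (_∈_; _⊆_)
open import Function.Bundles using (_⇔_; mk⇔; Equivalence)
open import Axiom.ExcludedMiddle using (ExcludedMiddle)
open import Data.Bool using (true; false)
open import Data.Product using (_,_)
open import Relation.Nullary using (yes; no; contradiction)
open import Relation.Binary.PropositionalEquality using (_≡_; refl)

module _ (em : ExcludedMiddle 0ℓ) {L : Set} where

  χ : 𝒫 L → Val L
  χ Γ x with em {x ∈ Γ}
  ... | yes _ = true
  ... | no _  = false

  χ-isChar : (Γ : 𝒫 L) → IsChar (χ Γ) Γ
  χ-isChar Γ x with em {x ∈ Γ}
  ... | yes x∈Γ = mk⇔ (λ _ → x∈Γ) (λ _ → refl)
  ... | no x∉Γ  = mk⇔ (λ ()) (λ x∈Γ → contradiction x∈Γ x∉Γ)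

  W-I-Sm-complete : (W : 𝒫 L → 𝒫 L) (Γ : 𝒫 L) → W-I (Sm L W) Γ ⊆ W Γ
  W-I-Sm-complete W Γ {α} α∈WI =
    Equivalence.to (χ-isChar (W Γ) α)
      (α∈WI (χ Γ) (χ (W Γ)) (Γ , χ-isChar Γ , χ-isChar (W Γ)) χΓ⊨Γ α refl)
    where
    χΓ⊨Γ : ∀ x → x ∈ Γ → χ Γ x ≡ true
    χΓ⊨Γ x = Equivalence.from (χ-isChar Γ x)

W-I-Sm-sound : {L : Set} (W : 𝒫 L → 𝒫 L) → Monotonic W → (Γ : 𝒫 L) → W Γ ⊆ W-I (Sm L W) Γ
W-I-Sm-sound W mono Γ α∈WΓ v w (Δ , χΔ , χWΔ) v⊨Γ α refl =
  Equivalence.from (χWΔ α) (mono Γ⊆Δ α∈WΓ)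
  where
  Γ⊆Δ : Γ ⊆ Δ
  Γ⊆Δ {x} x∈Γ = Equivalence.to (χΔ x) (v⊨Γ x x∈Γ)

mainTheorem8 : ExcludedMiddle 0ℓ →
    (𝓛 : Set) (W : 𝒫 𝓛 → 𝒫 𝓛) → Monotonic W →
    Normal (Sm 𝓛 W) →
    ∀ (Γ : 𝒫 𝓛) (α : 𝓛) → (α ∈ W Γ) ⇔ (α ∈ W-I (Sm 𝓛 W) Γ)
mainTheorem8 em 𝓛 W mono _ Γ α =
  mk⇔ (W-I-Sm-sound W mono Γ) (W-I-Sm-complete em W Γ)
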